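{- Let $p$ be an odd prime such that $2$ is a primitive element of $\mathbb{F}_p$ (i.e. the class of $2$ generates the cyclic group $\mathbb{F}_p^*$). Consider the following procedure, whose input is an integer $b$ with $1 \le b \le p-1$ (representing an element of $\mathbb{F}_p^*$): set $\mathrm{Out} = 0$; if $b = 1$, return $0$; otherwise, while $b \neq 1$, let $k$ be the largest integer such that $2^k$ divides $b$; if $k = 0$, replace $b$ by $p - b$ and replace $\mathrm{Out}$ by $\mathrm{Out} + (p-1)/2 \bmod (p-1)$; if $k \geq 1$, replace $b$ by $b/2^k$ and replace $\mathrm{Out}$ by $\mathrm{Out} + k \bmod (p-1)$. When the loop ends, return $\mathrm{Out}$. Then for every input $b$ with $1 \le b \le p-1$ this procedure terminates after finitely many iterations, and its output $\mathrm{Out}$ satisfies $2^{\mathrm{Out}} \equiv b \pmod p$, i.e. $\mathrm{Out}$ is the discrete logarithm of $b$ to base $2$ in $\mathbb{F}_p^*$ (modulo $p-1$).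
   Context: The discrete logarithm of $b \in \mathbb{F}_p^*$ to base $2$ (when $2$ is primitive) is the integer $n$, unique modulo $p-1$, with $2^n \equiv b \pmod p$. -}

module Defs where

open import Data.Nat using (ℕ; zero; suc; _+_; _*_; _∸_; _^_; _≤_; _<_; NonZero)
open import Data.Nat.DivMod using (_%_; _/_)
open import Data.Nat.Divisibility using (_∣_)
open import Data.Nat.Primality using (Prime)
open import Data.Product using (∃; ∃-syntax)
open import Relation.Nullary using (¬_)
open import Relation.Binary.PropositionalEquality using (_≡_; _≢_)

IsPrimitiveTwo : (p : ℕ) .{{_ : NonZero p}} → Set
IsPrimitiveTwo p = ∀ b → 1 ≤ b → b ≤ p ∸ 1 → ∃[ n ] (2 ^ n % p ≡ b % p)

IsLargestTwoPower : ℕ → ℕ → Set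
IsLargestTwoPower k b = (2 ^ k ∣ b) × ¬ (2 ^ suc k ∣ b)
  where open import Data.Product using (_×_)

-- The procedure, as a (big-step) execution relation:
-- Runs p b out res  means: the while-loop started in state (b , out)
-- terminates after finitely many iterations and returns res.
data Runs (p : ℕ) .{{_ : NonZero (p ∸ 1)}} : ℕ → ℕ → ℕ → Set where
  done  : ∀ {out} → Runs p 1 out out
  odd   : ∀ {b out res} → b ≢ 1 → IsLargestTwoPower 0 b →
          Runs p (p ∸ b) ((out + (p ∸ 1) / 2) % (p ∸ 1)) res →
          Runs p b out res
  even  : ∀ {b out res k q} → b ≢ 1 → IsLargestTwoPower k b → 1 ≤ k →
          b ≡ q * 2 ^ k →
          Runs p q ((out + k) % (p ∸ 1)) res →
          Runs p b out res

-- Correctness is a loop invariant: 2^Out · b stays congruent to the input. An even step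
-- moves the factor 2^k from b into 2^Out; an odd step replaces b by p - b ≡ -b and adds
-- N/2 to Out, which compensates because 2^(N/2) ≡ -1. Both this Euler congruence and
-- Fermat's 2^N ≡ 1 (needed since Out is reduced mod N) follow from primitivity: by
-- pigeonhole 2 has order exactly N, and 2^(N/2) is a square root of 1 different from 1.
--
-- Termination: every state b is ±2^m (mod p) for some m. An odd step keeps m, an even step
-- dividing by 2^k lowers m by k (it cannot overshoot, because b < p), and an odd step is
-- always followed by an even one; strong induction on m therefore builds a finite run.
module Submission where

open import Defs
open import Data.Nat using (ℕ; zero; suc; _+_; _*_; _∸_; _^_; _≤_; _<_; z≤n; s≤s; z<s; NonZero; _≟_; _<?_; >-nonZero; >-nonZero⁻¹; nonTrivial⇒n>1)
open import Data.Nat.Properties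
open import Data.Nat.DivMod using (_%_; _/_; m%n%n≡m%n; %-distribˡ-*; m<n⇒m%n≡m; %-remove-+ʳ; m%n<n; m≡m%n+[m/n]*n; n%n≡0; m*n%n≡0; m/n*n≡m)
open import Data.Nat.Divisibility using (_∣_; divides; _∣?_; ∣⇒≤; ∣1⇒≡1; ∣n⇒∣m*n; ∣m∣n⇒∣m+n; ∣m+n∣m⇒∣n; n∣m⇒m%n≡0; m%n≡0⇒n∣m; ∣-refl)
open import Data.Nat.Primality using (Prime; euclidsLemma; prime⇒nonTrivial)
open import Data.Product using (_×_; _,_; proj₁; proj₂; ∃-syntax; map₂)
open import Data.Sum using (_⊎_; inj₁; inj₂; [_,_]′)
open import Data.Fin using (Fin; toℕ; fromℕ<)
open import Data.Fin.Properties using (pigeonhole; toℕ<n; fromℕ<-injective; toℕ-injective)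
open import Data.Nat.Tactic.RingSolver using (solve-∀)
open import Data.Nat.Induction using (<-rec)
open import Data.Empty using (⊥-elim)
open import Relation.Nullary using (¬_; yes; no)
open import Relation.Binary.PropositionalEquality
open import Function using (_∘_)

2∤1 : ¬ 2 ∣ 1
2∤1 2∣1 = <⇒≢ (s≤s (s≤s z≤n)) (sym (∣1⇒≡1 2∣1))

parity : ∀ n → 2 ∣ n ⊎ 2 ∣ suc n
parity zero    = inj₁ (divides 0 refl)
parity (suc n) with parity n
... | inj₁ (divides q n≡q*2) = inj₂ (divides (suc q) (cong (suc ∘ suc) n≡q*2))
... | inj₂ 2∣1+n = inj₁ 2∣1+n

odd+odd : ∀ {x y} → ¬ 2 ∣ x → ¬ 2 ∣ y → 2 ∣ x + y
odd+odd {x} {y} x-odd y-odd = ∣m+n∣m⇒∣n 2∣2+x+y (divides 1 refl)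
  where
    succOfOdd : ∀ {n} → ¬ 2 ∣ n → 2 ∣ suc n
    succOfOdd {n} n-odd = [ (λ 2∣n → ⊥-elim (n-odd 2∣n)) , (λ 2∣1+n → 2∣1+n) ]′ (parity n)
    1+x+1+y≡2+x+y : suc x + suc y ≡ 2 + (x + y)
    1+x+1+y≡2+x+y = cong suc (+-suc x y)
    2∣2+x+y : 2 ∣ 2 + (x + y)
    2∣2+x+y = subst (2 ∣_) 1+x+1+y≡2+x+y (∣m∣n⇒∣m+n (succOfOdd x-odd) (succOfOdd y-odd))

OddPart : ℕ → ℕ → ℕ → Set
OddPart c k q = c ≡ q * 2 ^ k × ¬ 2 ∣ q

oddPart⇒largest : ∀ {c k q} → OddPart c k q → IsLargestTwoPower k c
oddPart⇒largest {c} {k} {q} (c≡q*2ᵏ , q-odd) = divides q c≡q*2ᵏ , 2ᵏ⁺¹∤c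
  where
    2ᵏ⁺¹∤c : ¬ 2 ^ suc k ∣ c
    2ᵏ⁺¹∤c (divides r c≡r*2ᵏ⁺¹) = q-odd (divides r (*-cancelʳ-≡ q (r * 2) (2 ^ k) {{m^n≢0 2 k}} (begin
      q * 2 ^ k       ≡⟨ c≡q*2ᵏ ⟨
      c               ≡⟨ c≡r*2ᵏ⁺¹ ⟩
      r * (2 * 2 ^ k) ≡⟨ *-assoc r 2 (2 ^ k) ⟨
      r * 2 * 2 ^ k   ∎)))
      where open ≡-Reasoning

oddPartExists : ∀ c → 1 ≤ c → ∃[ k ] ∃[ q ] OddPart c k q
oddPartExists = <-rec (λ c → 1 ≤ c → ∃[ k ] ∃[ q ] OddPart c k q) halving
  where
    halving : ∀ c → (∀ {m} → m < c → 1 ≤ m → ∃[ k ] ∃[ q ] OddPart m k q) →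
              1 ≤ c → ∃[ k ] ∃[ q ] OddPart c k q
    halving c rec c≥1 with 2 ∣? c
    ... | no c-odd = 0 , c , sym (*-identityʳ c) , c-odd
    ... | yes (divides zero refl) = ⊥-elim (n≮0 c≥1)
    ... | yes (divides m@(suc _) refl) with rec (m<m*n m 2 (s≤s (s≤s z≤n))) (s≤s z≤n)
    ... | k , q , m≡q*2ᵏ , q-odd = suc k , q , doubled , q-odd
      where
        doubled : m * 2 ≡ q * 2 ^ suc k
        doubled = begin
          m * 2           ≡⟨ cong (_* 2) m≡q*2ᵏ ⟩
          q * 2 ^ k * 2   ≡⟨ *-assoc q (2 ^ k) 2 ⟩
          q * (2 ^ k * 2) ≡⟨ cong (q *_) (*-comm (2 ^ k) 2) ⟩
          q * 2 ^ suc k   ∎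
          where open ≡-Reasoning

evenOddPart : ∀ c → 1 ≤ c → 2 ∣ c → ∃[ k ] ∃[ q ] OddPart c (suc k) q
evenOddPart c c≥1 2∣c with oddPartExists c c≥1
... | zero  , q , c≡q*1 , q-odd = ⊥-elim (q-odd (subst (2 ∣_) (trans c≡q*1 (*-identityʳ q)) 2∣c))
... | suc k , q , oddPart     = k , q , oddPart

module Congruence (p : ℕ) .{{_ : NonZero p}} where

  infix 4 _≈_
  _≈_ : ℕ → ℕ → Set
  a ≈ b = a % p ≡ b % p

  p>0 : 0 < p
  p>0 = >-nonZero⁻¹ p

  1+[p∸1]≡p : suc (p ∸ 1) ≡ p
  1+[p∸1]≡p = m+[n∸m]≡n p>0

  p∸1<p : p ∸ 1 < p
  p∸1<p = ∸-monoʳ-< {p} {1} {0} z<s p>0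

  ≈-reflexive : ∀ {a b} → a ≡ b → a ≈ b
  ≈-reflexive = cong (_% p)

  %-≈ : ∀ a → a % p ≈ a
  %-≈ a = m%n%n≡m%n a p

  *-cong : ∀ {a b c d} → a ≈ b → c ≈ d → a * c ≈ b * d
  *-cong {a} {b} {c} {d} a≈b c≈d = begin
      (a * c) % p             ≡⟨ %-distribˡ-* a c p ⟩
      ((a % p) * (c % p)) % p ≡⟨ cong₂ (λ x y → (x * y) % p) a≈b c≈d ⟩
      ((b % p) * (d % p)) % p ≡⟨ %-distribˡ-* b d p ⟨
      (b * d) % p             ∎
    where open ≡-Reasoning

  *-congˡ : ∀ {a b} c → a ≈ b → a * c ≈ b * c
  *-congˡ {a} {b} c a≈b = *-cong {a} {b} {c} {c} a≈b refl

  *-congʳ : ∀ a {c d} → c ≈ d → a * c ≈ a * d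
  *-congʳ a {c} {d} c≈d = *-cong {a} {a} {c} {d} refl c≈d

  ≈-canonical : ∀ {a b} → a < p → b < p → a ≈ b → a ≡ b
  ≈-canonical a<p b<p a≈b = trans (sym (m<n⇒m%n≡m a<p)) (trans a≈b (m<n⇒m%n≡m b<p))

  ≈⇒∣∸ : ∀ {a b} → a ≤ b → a ≈ b → p ∣ b ∸ a
  ≈⇒∣∸ {a} {b} a≤b a≈b = divides (b / p ∸ a / p) (begin
      b ∸ a                                         ≡⟨ cong₂ _∸_ (m≡m%n+[m/n]*n b p) (m≡m%n+[m/n]*n a p) ⟩
      (b % p + (b / p) * p) ∸ (a % p + (a / p) * p) ≡⟨ cong (λ r → (b % p + (b / p) * p) ∸ (r + (a / p) * p)) a≈b ⟩
      (b % p + (b / p) * p) ∸ (b % p + (a / p) * p) ≡⟨ [m+n]∸[m+o]≡n∸o (b % p) _ _ ⟩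
      (b / p) * p ∸ (a / p) * p                     ≡⟨ *-distribʳ-∸ p (b / p) (a / p) ⟨
      (b / p ∸ a / p) * p                           ∎)
    where open ≡-Reasoning

  ∣∸⇒≈ : ∀ {a b} → a ≤ b → p ∣ b ∸ a → a ≈ b
  ∣∸⇒≈ {a} {b} a≤b p∣b∸a = sym (trans (cong (_% p) (sym (m+[n∸m]≡n a≤b))) (%-remove-+ʳ a p∣b∸a))

  +-cancelˡ-≈ : ∀ c {a b} → c + a ≈ c + b → a ≈ b
  +-cancelˡ-≈ c {a} {b} e = [ (λ a≤b → cancel≤ a≤b e) , (λ b≤a → sym (cancel≤ b≤a (sym e))) ]′ (≤-total a b)
    where
      cancel≤ : ∀ {x y} → x ≤ y → c + x ≈ c + y → x ≈ y
      cancel≤ {x} {y} x≤y e = ∣∸⇒≈ x≤y (subst (p ∣_) ([m+n]∸[m+o]≡n∸o c y x) (≈⇒∣∸ (+-monoʳ-≤ c x≤y) e))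

  ^-congˡ : ∀ {a b} n → a ≈ b → a ^ n ≈ b ^ n
  ^-congˡ zero    a≈b = refl
  ^-congˡ (suc n) a≈b = *-cong a≈b (^-congˡ n a≈b)

  ∣⇒≈0 : ∀ {a} → p ∣ a → a ≈ 0
  ∣⇒≈0 {a} p∣a = trans (n∣m⇒m%n≡0 a p p∣a) (sym (m<n⇒m%n≡m p>0))

  -- p - c is congruent to (p - 1) * c, i.e. p - 1 plays the role of -1:
  -- both become ≡ 0 after adding c.
  ∸≈minusOne* : ∀ c → c ≤ p → p ∸ c ≈ (p ∸ 1) * c
  ∸≈minusOne* c c≤p = +-cancelˡ-≈ c (begin
      (c + (p ∸ c)) % p     ≡⟨ cong (_% p) (m+[n∸m]≡n c≤p) ⟩
      p % p                 ≡⟨ n%n≡0 p ⟩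
      0                     ≡⟨ m*n%n≡0 c p ⟨
      (c * p) % p           ≡⟨ cong (λ q → (c * q) % p) (sym 1+[p∸1]≡p) ⟩
      (c * suc (p ∸ 1)) % p ≡⟨ cong (_% p) (*-comm c (suc (p ∸ 1))) ⟩
      (c + (p ∸ 1) * c) % p ∎)
    where open ≡-Reasoning

  minusOne²≈1 : (p ∸ 1) * (p ∸ 1) ≈ 1
  minusOne²≈1 = trans (sym (∸≈minusOne* (p ∸ 1) (m∸n≤m p 1))) (≈-reflexive (m∸[m∸n]≡n p>0))

module PrimeCongruence (p : ℕ) .{{_ : NonZero p}} (p-prime : Prime p) where

  open Congruence p

  p>1 : 1 < p
  p>1 = nonTrivial⇒n>1 p {{prime⇒nonTrivial p-prime}}

  -- Euclid's lemma lets us cancel a factor that p does not divide.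
  *-cancelʳ-≈ : ∀ {a} → ¬ p ∣ a → ∀ {x y} → x * a ≈ y * a → x ≈ y
  *-cancelʳ-≈ {a} p∤a {x} {y} e = [ (λ x≤y → cancel≤ x≤y e) , (λ y≤x → sym (cancel≤ y≤x (sym e))) ]′ (≤-total x y)
    where
      cancel≤ : ∀ {u v} → u ≤ v → u * a ≈ v * a → u ≈ v
      cancel≤ {u} {v} u≤v e with euclidsLemma (v ∸ u) a p-prime
                                   (subst (p ∣_) (sym (*-distribʳ-∸ a v u)) (≈⇒∣∸ (*-monoˡ-≤ a u≤v) e))
      ... | inj₁ p∣v∸u = ∣∸⇒≈ u≤v p∣v∸u
      ... | inj₂ p∣a = ⊥-elim (p∤a p∣a)

  ∤-^ : ∀ {a} → ¬ p ∣ a → ∀ n → ¬ p ∣ a ^ n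
  ∤-^ p∤a zero p∣1 = <⇒≢ p>1 (sym (∣1⇒≡1 p∣1))
  ∤-^ {a} p∤a (suc n) p∣aⁿ⁺¹ with euclidsLemma a (a ^ n) p-prime p∣aⁿ⁺¹
  ... | inj₁ p∣a = p∤a p∣a
  ... | inj₂ p∣aⁿ = ∤-^ p∤a n p∣aⁿ

  -- A residue r < p with r² ≡ 1 is 1 or p - 1, since p ∣ r² - 1 = (r - 1)(r + 1).
  residueRootsOfOne : ∀ r → r < p → r * r ≈ 1 → r ≡ 1 ⊎ r ≡ p ∸ 1
  residueRootsOfOne zero _ 0≈1 = ⊥-elim (0≢1+n (≈-canonical p>0 p>1 0≈1))
  residueRootsOfOne (suc r) r+1<p rr≈1 with euclidsLemma r (suc (suc r)) p-prime p∣r[r+2]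
    where
      p∣r[r+2] : p ∣ r * suc (suc r)
      p∣r[r+2] = subst (p ∣_) (sym (*-suc r (suc r))) (≈⇒∣∸ (s≤s z≤n) (sym rr≈1))
  ... | inj₁ p∣r = inj₁ (cong suc (≈-canonical (<-trans (n<1+n r) r+1<p) p>0 (∣⇒≈0 p∣r)))
  ... | inj₂ p∣r+2 = inj₂ (cong (_∸ 1) (≤-antisym r+1<p (∣⇒≤ p∣r+2)))

  squareRootsOfOne : ∀ x → x * x ≈ 1 → x ≈ 1 ⊎ x ≈ p ∸ 1
  squareRootsOfOne x xx≈1 with residueRootsOfOne (x % p) (m%n<n x p) (trans (*-cong (%-≈ x) (%-≈ x)) xx≈1)
  ... | inj₁ r≡1 = inj₁ (trans r≡1 (sym (m<n⇒m%n≡m p>1)))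
  ... | inj₂ r≡p∸1 = inj₂ (trans r≡p∸1 (sym (m<n⇒m%n≡m p∸1<p)))

module Powers (p : ℕ) .{{_ : NonZero p}} (p-prime : Prime p) (a : ℕ) (p∤a : ¬ p ∣ a) where

  open PrimeCongruence p p-prime
  open Congruence p

  ^-residue≥1 : ∀ n → 1 ≤ a ^ n % p
  ^-residue≥1 n with a ^ n % p in r≡0
  ... | zero  = ⊥-elim (∤-^ p∤a n (m%n≡0⇒n∣m (a ^ n) p r≡0))
  ... | suc _ = s≤s z≤n

  residueCode : ℕ → Fin (p ∸ 1)
  residueCode n = fromℕ< (∸-monoˡ-< (m%n<n (a ^ n) p) (^-residue≥1 n))

  residueCode-injective : ∀ m n → residueCode m ≡ residueCode n → a ^ m ≈ a ^ n
  residueCode-injective m n eq = ∸-cancelʳ-≡ (^-residue≥1 m) (^-residue≥1 n) (fromℕ<-injective _ _ _ _ eq)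

  -- Pigeonhole on the p powers a^0, …, a^(p-1): a^i ≡ a^j with i < j, so a^(j-i) ≡ 1.
  periodExists : ∃[ d ] (1 ≤ d × d ≤ p ∸ 1 × a ^ d ≈ 1)
  periodExists with pigeonhole p∸1<p (λ i → residueCode (toℕ i))
  ... | i , j , i<j , eq = toℕ j ∸ toℕ i , m<n⇒0<n∸m i<j , d≤p∸1 , aᵈ≈1
    where
      d≤p∸1 : toℕ j ∸ toℕ i ≤ p ∸ 1
      d≤p∸1 = ≤-trans (m∸n≤m (toℕ j) (toℕ i)) (∸-monoˡ-≤ 1 (toℕ<n j))
      aᵈ≈1 : a ^ (toℕ j ∸ toℕ i) ≈ 1
      aᵈ≈1 = sym (*-cancelʳ-≈ (∤-^ p∤a (toℕ i)) (begin
        (1 * a ^ toℕ i) % p                        ≡⟨ cong (_% p) (*-identityˡ (a ^ toℕ i)) ⟩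
        a ^ toℕ i % p                              ≡⟨ residueCode-injective (toℕ i) (toℕ j) eq ⟩
        a ^ toℕ j % p                              ≡⟨ cong (λ e → a ^ e % p) (m∸n+n≡m (<⇒≤ i<j)) ⟨
        a ^ (toℕ j ∸ toℕ i + toℕ i) % p            ≡⟨ cong (_% p) (^-distribˡ-+-* a (toℕ j ∸ toℕ i) (toℕ i)) ⟩
        (a ^ (toℕ j ∸ toℕ i) * a ^ toℕ i) % p      ∎))
        where open ≡-Reasoning

  ^-%-period : ∀ d .{{_ : NonZero d}} → a ^ d ≈ 1 → ∀ n → a ^ (n % d) ≈ a ^ n
  ^-%-period d aᵈ≈1 n = begin
      a ^ (n % d) % p                         ≡⟨ cong (_% p) (*-identityʳ (a ^ (n % d))) ⟨
      (a ^ (n % d) * 1) % p                   ≡⟨ cong (λ x → (a ^ (n % d) * x) % p) (^-zeroˡ (n / d)) ⟨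
      (a ^ (n % d) * 1 ^ (n / d)) % p         ≡⟨ *-congʳ (a ^ (n % d)) (sym (^-congˡ (n / d) aᵈ≈1)) ⟩
      (a ^ (n % d) * (a ^ d) ^ (n / d)) % p   ≡⟨ cong (λ x → (a ^ (n % d) * x) % p) (^-*-assoc a d (n / d)) ⟩
      (a ^ (n % d) * a ^ (d * (n / d))) % p   ≡⟨ cong (λ x → (a ^ (n % d) * a ^ x) % p) (*-comm d (n / d)) ⟩
      (a ^ (n % d) * a ^ (n / d * d)) % p     ≡⟨ cong (_% p) (^-distribˡ-+-* a (n % d) (n / d * d)) ⟨
      a ^ (n % d + n / d * d) % p             ≡⟨ cong (λ x → a ^ x % p) (m≡m%n+[m/n]*n n d) ⟨
      a ^ n % p                               ∎
    where open ≡-Reasoning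

module PrimitiveTwo (p : ℕ) .{{_ : NonZero p}} (p-prime : Prime p) (p-odd : ¬ 2 ∣ p)
                    (two-primitive : IsPrimitiveTwo p) where

  open Congruence p
  open PrimeCongruence p p-prime

  N : ℕ
  N = p ∸ 1

  p∤2 : ¬ p ∣ 2
  p∤2 p∣2 = p-odd (subst (2 ∣_) (sym (≤-antisym (∣⇒≤ p∣2) p>1)) ∣-refl)

  N≥1 : 1 ≤ N
  N≥1 = ∸-monoˡ-≤ 1 p>1

  open Powers p p-prime 2 p∤2

  dlog : Fin N → ℕ
  dlog i = proj₁ (two-primitive (suc (toℕ i)) (s≤s z≤n) (toℕ<n i))

  dlog-spec : ∀ i → 2 ^ dlog i ≈ suc (toℕ i)
  dlog-spec i = proj₂ (two-primitive (suc (toℕ i)) (s≤s z≤n) (toℕ<n i))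

  -- If 2^d ≡ 1 then 2^e depends only on e mod d, so the N elements 1, …, N have
  -- discrete logarithms that are distinct modulo d.
  dlog-injective-mod : ∀ d .{{_ : NonZero d}} → 2 ^ d ≈ 1 → ∀ i j → dlog i % d ≡ dlog j % d → i ≡ j
  dlog-injective-mod d 2ᵈ≈1 i j eq = toℕ-injective (suc-injective (≈-canonical (below i) (below j) (begin
      suc (toℕ i) % p     ≡⟨ dlog-spec i ⟨
      2 ^ dlog i % p       ≡⟨ ^-%-period d 2ᵈ≈1 (dlog i) ⟨
      2 ^ (dlog i % d) % p ≡⟨ cong (λ e → 2 ^ e % p) eq ⟩
      2 ^ (dlog j % d) % p ≡⟨ ^-%-period d 2ᵈ≈1 (dlog j) ⟩
      2 ^ dlog j % p       ≡⟨ dlog-spec j ⟩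
      suc (toℕ j) % p     ∎)))
    where
      open ≡-Reasoning
      below : (k : Fin N) → suc (toℕ k) < p
      below k = ≤-<-trans (toℕ<n k) p∸1<p

  -- 2 has order at least N: otherwise pigeonhole contradicts dlog-injective-mod.
  orderOfTwo : ∀ d → 1 ≤ d → 2 ^ d ≈ 1 → N ≤ d
  orderOfTwo d@(suc _) _ 2ᵈ≈1 with d <? N
  ... | no d≮N = ≮⇒≥ d≮N
  ... | yes d<N with pigeonhole d<N (λ i → fromℕ< (m%n<n (dlog i) d))
  ... | i , j , i<j , eq =
        ⊥-elim (<⇒≢ i<j (cong toℕ (dlog-injective-mod d 2ᵈ≈1 i j (fromℕ<-injective _ _ _ _ eq))))

  -- Fermat: some period d ≤ N exists and is at least N by orderOfTwo.
  fermat : 2 ^ N ≈ 1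
  fermat with periodExists
  ... | d , 1≤d , d≤N , 2ᵈ≈1 = subst (λ e → 2 ^ e ≈ 1) (≤-antisym d≤N (orderOfTwo d 1≤d 2ᵈ≈1)) 2ᵈ≈1

  2∣N : 2 ∣ N
  2∣N = [ (λ 2∣N → 2∣N) , (λ 2∣1+N → ⊥-elim (p-odd (subst (2 ∣_) 1+[p∸1]≡p 2∣1+N))) ]′ (parity N)

  h : ℕ
  h = N / 2

  N≡h+h : N ≡ h + h
  N≡h+h = trans (sym (m/n*n≡m 2∣N)) (trans (*-comm h 2) (cong (h +_) (+-identityʳ h)))

  h≥1 : 1 ≤ h
  h≥1 = n≢0⇒n>0 (λ h≡0 → <⇒≢ N≥1 (sym (trans N≡h+h (cong (λ x → x + x) h≡0))))

  h<N : h < N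
  h<N = subst (h <_) (sym N≡h+h) (m<m+n h h≥1)

  -- 2^h squares to 2^N ≡ 1, so it is ±1; it is not 1 because h < N is below the order.
  euler : 2 ^ h ≈ N
  euler with squareRootsOfOne (2 ^ h) 2ʰ*2ʰ≈1
    where
      2ʰ*2ʰ≈1 : 2 ^ h * 2 ^ h ≈ 1
      2ʰ*2ʰ≈1 = trans (≈-reflexive (sym (^-distribˡ-+-* 2 h h))) (subst (λ e → 2 ^ e ≈ 1) N≡h+h fermat)
  ... | inj₁ 2ʰ≈1 = ⊥-elim (<⇒≱ h<N (orderOfTwo h h≥1 2ʰ≈1))
  ... | inj₂ 2ʰ≈N = 2ʰ≈N

module Procedure (p : ℕ) .{{_ : NonZero p}} .{{_ : NonZero (p ∸ 1)}} (p-prime : Prime p) (p-odd : ¬ 2 ∣ p)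
                 (two-primitive : IsPrimitiveTwo p) where

  open Congruence p
  open PrimeCongruence p p-prime
  open PrimitiveTwo p p-prime p-odd two-primitive
  open Powers p p-prime 2 p∤2 using (^-%-period)

  ^-%N : ∀ e → 2 ^ (e % N) ≈ 2 ^ e
  ^-%N = ^-%-period N fermat

  oddStep-invariant : ∀ out c → c ≤ p → 2 ^ ((out + h) % N) * (p ∸ c) ≈ 2 ^ out * c
  oddStep-invariant out c c≤p = begin
      2 ^ ((out + h) % N) * (p ∸ c) % p ≡⟨ *-cong (^-%N (out + h)) (∸≈minusOne* c c≤p) ⟩
      2 ^ (out + h) * (N * c) % p       ≡⟨ cong (λ x → x * (N * c) % p) (^-distribˡ-+-* 2 out h) ⟩
      2 ^ out * 2 ^ h * (N * c) % p     ≡⟨ *-congˡ (N * c) (*-congʳ (2 ^ out) euler) ⟩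
      2 ^ out * N * (N * c) % p         ≡⟨ cong (_% p) (regroup (2 ^ out) N c) ⟩
      2 ^ out * (N * N) * c % p         ≡⟨ *-congˡ c (*-congʳ (2 ^ out) minusOne²≈1) ⟩
      2 ^ out * 1 * c % p               ≡⟨ cong (λ x → x * c % p) (*-identityʳ (2 ^ out)) ⟩
      2 ^ out * c % p                   ∎
    where
      open ≡-Reasoning
      regroup : ∀ x n c → x * n * (n * c) ≡ x * (n * n) * c
      regroup = solve-∀

  evenStep-invariant : ∀ out c k q → c ≡ q * 2 ^ k → 2 ^ ((out + k) % N) * q ≈ 2 ^ out * c
  evenStep-invariant out c k q c≡q*2ᵏ = begin
      2 ^ ((out + k) % N) * q % p ≡⟨ *-congˡ q (^-%N (out + k)) ⟩
      2 ^ (out + k) * q % p       ≡⟨ cong (_% p) (regroup out k q) ⟩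
      2 ^ out * (q * 2 ^ k) % p   ≡⟨ cong (λ x → 2 ^ out * x % p) c≡q*2ᵏ ⟨
      2 ^ out * c % p             ∎
    where
      open ≡-Reasoning
      commuteLast : ∀ x y z → x * y * z ≡ x * (z * y)
      commuteLast = solve-∀
      regroup : ∀ out k q → 2 ^ (out + k) * q ≡ 2 ^ out * (q * 2 ^ k)
      regroup out k q = trans (cong (_* q) (^-distribˡ-+-* 2 out k)) (commuteLast (2 ^ out) (2 ^ k) q)

  runs-correct : ∀ {b c out res} → c ≤ p → Runs p c out res → 2 ^ out * c ≈ b → 2 ^ res ≈ b
  runs-correct {out = out} _ done 2ᵒᵘᵗ*1≈b = trans (≈-reflexive (sym (*-identityʳ (2 ^ out)))) 2ᵒᵘᵗ*1≈b
  runs-correct {c = c} {out} c≤p (odd _ _ run) inv =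
    runs-correct (m∸n≤m p c) run (trans (oddStep-invariant out c c≤p) inv)
  runs-correct {c = c} {out} c≤p (even {k = k} {q} _ _ _ c≡q*2ᵏ run) inv =
    runs-correct (≤-trans q≤c c≤p) run (trans (evenStep-invariant out c k q c≡q*2ᵏ) inv)
    where
      q≤c : q ≤ c
      q≤c = subst (q ≤_) (sym c≡q*2ᵏ) (m≤m*n q (2 ^ k) {{m^n≢0 2 k}})

  infix 4 _≈±2^_
  _≈±2^_ : ℕ → ℕ → Set
  c ≈±2^ m = c ≈ 2 ^ m ⊎ c ≈ N * 2 ^ m

  -- Replacing c by p - c swaps the two signs, as N · N ≡ 1.
  ±-negate : ∀ {c m} → c ≤ p → c ≈±2^ m → p ∸ c ≈±2^ m
  ±-negate {c} c≤p (inj₁ c≈2ᵐ) = inj₂ (trans (∸≈minusOne* c c≤p) (*-congʳ N c≈2ᵐ))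
  ±-negate {c} {m} c≤p (inj₂ c≈N2ᵐ) = inj₁ (begin
      (p ∸ c) % p         ≡⟨ ∸≈minusOne* c c≤p ⟩
      N * c % p           ≡⟨ *-congʳ N c≈N2ᵐ ⟩
      N * (N * 2 ^ m) % p ≡⟨ cong (_% p) (*-assoc N N (2 ^ m)) ⟨
      N * N * 2 ^ m % p   ≡⟨ *-congˡ (2 ^ m) minusOne²≈1 ⟩
      1 * 2 ^ m % p       ≡⟨ cong (_% p) (*-identityˡ (2 ^ m)) ⟩
      2 ^ m % p           ∎)
    where open ≡-Reasoning

  -- A common power of two can be cancelled, as p is odd.
  ±-cancel : ∀ {x i j} → x * 2 ^ j ≈±2^ (i + j) → x ≈±2^ i
  ±-cancel {x} {i} {j} (inj₁ e) = inj₁ (*-cancelʳ-≈ (∤-^ p∤2 j)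
    (trans e (≈-reflexive (^-distribˡ-+-* 2 i j))))
  ±-cancel {x} {i} {j} (inj₂ e) = inj₂ (*-cancelʳ-≈ (∤-^ p∤2 j)
    (trans e (≈-reflexive (trans (cong (N *_) (^-distribˡ-+-* 2 i j)) (sym (*-assoc N (2 ^ i) (2 ^ j)))))))

  ±-one : ∀ {x} → x < p → x ≈±2^ 0 → x ≡ 1 ⊎ x ≡ N
  ±-one x<p (inj₁ x≈1)  = inj₁ (≈-canonical x<p p>1 x≈1)
  ±-one x<p (inj₂ x≈N*1) = inj₂ (≈-canonical x<p p∸1<p (trans x≈N*1 (≈-reflexive (*-identityʳ N))))

  -- The loop invariant: 1 ≤ c ≤ N, c ≡ ±2^m, and c = N only if m ≥ 1
  -- (the representation N ≡ -2^0 is the one from which an even step would not lower m).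
  record Admissible (c m : ℕ) : Set where
    field
      positive    : 1 ≤ c
      bounded     : c ≤ N
      signedPower : c ≈±2^ m
      minusOne    : c ≡ N → 1 ≤ m

  open Admissible

  -- An admissible c is never N · 2^m: for m = 0 that is excluded, and for m ≥ 1 it exceeds N.
  ≢N*2ᵐ : ∀ {c m} → Admissible c m → c ≢ N * 2 ^ m
  ≢N*2ᵐ {m = zero}  adm c≡N*1 = n≮0 (minusOne adm (trans c≡N*1 (*-identityʳ N)))
  ≢N*2ᵐ {m = suc m} adm c≡N*2ᵐ = <⇒≱ N<N*2ᵐ (subst (_≤ N) c≡N*2ᵐ (bounded adm))
    where
      N<N*2ᵐ : N < N * 2 ^ suc m
      N<N*2ᵐ = m<m*n N (2 ^ suc m) (^-monoʳ-< 2 (s≤s (s≤s z≤n)) {0} {suc m} z<s)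

  -- An admissible c ≡ ±2^m is not x · 2^m with x even: cancelling 2^m gives x ≡ ±1,
  -- and x ≤ c < p with x even leaves only x = N, excluded by ≢N*2ᵐ.
  noEvenCofactor : ∀ {c m q i} → Admissible c m → c ≢ q * 2 ^ suc i * 2 ^ m
  noEvenCofactor {c} {m} {q} {i} adm c≡x*2ᵐ with ±-one x<p (±-cancel {x} {0} {m} x*2ᵐ≈±2ᵐ)
    where
      x : ℕ
      x = q * 2 ^ suc i
      x<p : x < p
      x<p = ≤-<-trans (subst (x ≤_) (sym c≡x*2ᵐ) (m≤m*n x (2 ^ m) {{m^n≢0 2 m}}))
                      (≤-<-trans (bounded adm) p∸1<p)
      x*2ᵐ≈±2ᵐ : x * 2 ^ m ≈±2^ m
      x*2ᵐ≈±2ᵐ = subst (_≈±2^ m) c≡x*2ᵐ (signedPower adm)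
  ... | inj₁ x≡1 = 2∤1 (subst (2 ∣_) x≡1 (∣n⇒∣m*n q (divides (2 ^ i) (*-comm 2 (2 ^ i)))))
  ... | inj₂ x≡N = ≢N*2ᵐ adm (trans c≡x*2ᵐ (cong (_* 2 ^ m) x≡N))

  exponentBound : ∀ {c m q k} → Admissible c m → c ≡ q * 2 ^ k → k ≤ m
  exponentBound {c} {m} {q} {k} adm c≡q*2ᵏ with k ≤? m
  ... | yes k≤m = k≤m
  ... | no k≰m = ⊥-elim (noEvenCofactor {q = q} {i = i} adm (begin
      c                       ≡⟨ c≡q*2ᵏ ⟩
      q * 2 ^ k               ≡⟨ cong (λ e → q * 2 ^ e) (m∸n+n≡m (≰⇒> k≰m)) ⟨
      q * 2 ^ (i + suc m)     ≡⟨ cong (λ e → q * 2 ^ e) (+-suc i m) ⟩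
      q * 2 ^ (suc i + m)     ≡⟨ cong (q *_) (^-distribˡ-+-* 2 (suc i) m) ⟩
      q * (2 ^ suc i * 2 ^ m) ≡⟨ *-assoc q (2 ^ suc i) (2 ^ m) ⟨
      q * 2 ^ suc i * 2 ^ m   ∎))
    where
      open ≡-Reasoning
      i : ℕ
      i = k ∸ suc m

  halve : ∀ {c m k q} → Admissible c m → OddPart c (suc k) q → suc k ≤ m × Admissible q (m ∸ suc k)
  halve {c} {m} {k} {q} adm (c≡q*2ᵏ⁺¹ , _) = k<m , record
    { positive    = q≥1
    ; bounded     = <⇒≤ (<-≤-trans q<c (bounded adm))
    ; signedPower = ±-cancel {q} {m ∸ suc k} {suc k}
        (subst₂ _≈±2^_ c≡q*2ᵏ⁺¹ (sym (m∸n+n≡m k<m)) (signedPower adm))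
    ; minusOne    = λ q≡N → ⊥-elim (<⇒≱ q<c (subst (c ≤_) (sym q≡N) (bounded adm)))
    }
    where
      k<m : suc k ≤ m
      k<m = exponentBound {q = q} {k = suc k} adm c≡q*2ᵏ⁺¹
      q≥1 : 1 ≤ q
      q≥1 = n≢0⇒n>0 (λ q≡0 → n≮0 (subst (1 ≤_) (trans c≡q*2ᵏ⁺¹ (cong (_* 2 ^ suc k) q≡0)) (positive adm)))
      q<c : q < c
      q<c = subst (q <_) (sym c≡q*2ᵏ⁺¹)
              (m<m*n q (2 ^ suc k) {{>-nonZero q≥1}} (^-monoʳ-< 2 (s≤s (s≤s z≤n)) {0} {suc k} z<s))

  reflect : ∀ {c m} → Admissible c m → c ≢ 1 → ¬ 2 ∣ c → Admissible (p ∸ c) m × 2 ∣ p ∸ c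
  reflect {c} {m} adm c≢1 c-odd = record
    { positive    = m<n⇒0<n∸m c<p
    ; bounded     = ∸-monoʳ-≤ p (positive adm)
    ; signedPower = ±-negate {c} {m} c≤p (signedPower adm)
    ; minusOne    = λ p∸c≡N → ⊥-elim (c≢1 (+-cancelʳ-≡ N c 1 (c+N≡1+N p∸c≡N)))
    } , p∸c-even
    where
      c<p : c < p
      c<p = ≤-<-trans (bounded adm) p∸1<p
      c≤p : c ≤ p
      c≤p = <⇒≤ c<p
      c+N≡1+N : p ∸ c ≡ N → c + N ≡ 1 + N
      c+N≡1+N p∸c≡N = begin
        c + N       ≡⟨ cong (c +_) p∸c≡N ⟨
        c + (p ∸ c) ≡⟨ m+[n∸m]≡n c≤p ⟩
        p           ≡⟨ 1+[p∸1]≡p ⟨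
        1 + N       ∎
        where open ≡-Reasoning
      p∸c-even : 2 ∣ p ∸ c
      p∸c-even with 2 ∣? (p ∸ c)
      ... | yes 2∣p∸c = 2∣p∸c
      ... | no p∸c-odd = ⊥-elim (p-odd (subst (2 ∣_) (m∸n+n≡m c≤p) (odd+odd p∸c-odd c-odd)))

  Terminates : ℕ → Set
  Terminates c = ∀ out → ∃[ res ] Runs p c out res

  evenTerminates : ∀ {m} → (∀ {m′} → m′ < m → ∀ {c} → Admissible c m′ → Terminates c) →
                   ∀ {c} → Admissible c m → 2 ∣ c → Terminates c
  evenTerminates {m} ih {c} adm 2∣c out with evenOddPart c (positive adm) 2∣c
  ... | k , q , oddPart@(c≡q*2ᵏ⁺¹ , _) with halve {k = k} adm oddPart
  ... | k<m , adm′ = map₂ (even c≢1 (oddPart⇒largest {k = suc k} oddPart) (s≤s z≤n) c≡q*2ᵏ⁺¹)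
                          (ih (∸-monoʳ-< {m} {suc k} {0} z<s k<m) adm′ ((out + suc k) % N))
    where
      c≢1 : c ≢ 1
      c≢1 c≡1 = 2∤1 (subst (2 ∣_) c≡1 2∣c)

  admissible-terminates : ∀ m {c} → Admissible c m → Terminates c
  admissible-terminates = <-rec (λ m → ∀ {c} → Admissible c m → Terminates c) step
    where
      step : ∀ m → (∀ {m′} → m′ < m → ∀ {c} → Admissible c m′ → Terminates c) →
             ∀ {c} → Admissible c m → Terminates c
      step m ih {c} adm out with c ≟ 1
      ... | yes refl = out , done
      ... | no c≢1 with 2 ∣? c
      ... | yes 2∣c = evenTerminates ih adm 2∣c out
      ... | no c-odd = map₂ (odd c≢1 (oddPart⇒largest {k = 0} (sym (*-identityʳ c) , c-odd)))
                            (evenTerminates ih (proj₁ reflected) (proj₂ reflected) ((out + h) % N))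
        where
          reflected : Admissible (p ∸ c) m × 2 ∣ p ∸ c
          reflected = reflect adm c≢1 c-odd

  -- An input b ≡ 2^n is admissible with exponent n + N ≥ 1, using 2^N ≡ 1.
  inputAdmissible : ∀ b → 1 ≤ b → b ≤ N → ∃[ m ] Admissible b m
  inputAdmissible b b≥1 b≤N with two-primitive b b≥1 b≤N
  ... | n , 2ⁿ≈b = n + N , record
    { positive    = b≥1
    ; bounded     = b≤N
    ; signedPower = inj₁ (sym (begin
        2 ^ (n + N) % p     ≡⟨ cong (_% p) (^-distribˡ-+-* 2 n N) ⟩
        2 ^ n * 2 ^ N % p   ≡⟨ *-congʳ (2 ^ n) fermat ⟩
        2 ^ n * 1 % p       ≡⟨ cong (_% p) (*-identityʳ (2 ^ n)) ⟩
        2 ^ n % p           ≡⟨ 2ⁿ≈b ⟩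
        b % p               ∎))
    ; minusOne    = λ _ → ≤-trans N≥1 (m≤n+m N n)
    }
    where open ≡-Reasoning

  procedure-terminates : ∀ b → 1 ≤ b → b ≤ N → Terminates b
  procedure-terminates b b≥1 b≤N with inputAdmissible b b≥1 b≤N
  ... | m , adm = admissible-terminates m adm

  procedure-correct : ∀ {b out} → b ≤ p → Runs p b 0 out → 2 ^ out ≈ b
  procedure-correct {b} b≤p run = runs-correct b≤p run (≈-reflexive (*-identityˡ b))

mainTheorem2 : (p : ℕ) → Prime p → ¬ (2 ∣ p) →
    .{{_ : NonZero p}} → .{{_ : NonZero (p ∸ 1)}} →
    IsPrimitiveTwo p →
    (b : ℕ) → 1 ≤ b → b ≤ p ∸ 1 →
      (∃[ out ] Runs p b 0 out) ×
      (∀ out → Runs p b 0 out → 2 ^ out % p ≡ b % p)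
mainTheorem2 p p-prime p-odd two-primitive b b≥1 b≤N =
    procedure-terminates b b≥1 b≤N 0
  , λ _ → procedure-correct (≤-trans b≤N (m∸n≤m p 1))
  where open Procedure p p-prime p-odd two-primitive
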